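{- For $r\ge0$, $$A(r) = \frac32\cdot 2^r - \frac12 \qquad\text{and}\qquad \tilde A(r) = \frac32\cdot 2^r - \frac{r+3}{2}.$$
   Context: The Stern sequence $(s(n))_{n\ge0}$ is defined by $s(0)=0$, $s(1)=1$, $s(2n)=s(n)$, $s(2n+1)=s(n)+s(n+1)$; $s(n+1)\ge 1$ for all $n\ge0$. Let $t(n)=s(n)/s(n+1)$. For $r\ge0$ define $A(r)=\sum_{n=2^r}^{2^{r+1}-1} t(n)$ and $\tilde A(r)=\sum_{n=0}^{2^r-1} t(n)$. -}

module Defs where

open import Data.Nat using (ℕ; zero; suc; _+_; _*_; _^_)
open import Data.Integer using (+_)
open import Data.Rational using (ℚ; _/_; 0ℚ) renaming (_+_ to _+ℚ_)

-- Stern sequence, via a fuel-indexed helper (fuel k suffices whenever n < k... we use n+1).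
-- sF k n computes s(n) provided k > number of halvings needed (k = n + 1 always suffices).
sF : ℕ → ℕ → ℕ
sF zero _ = 0
sF (suc k) zero = 0
sF (suc k) (suc zero) = 1
sF (suc k) (suc (suc m)) = go m
  where
  go : ℕ → ℕ
  go m' = step m' 0
    where
    -- step j q : invariant m = j + 2q ; when j = 0, n = 2(q+1) ; when j = 1, n = 2(q+1)+1
    step : ℕ → ℕ → ℕ
    step zero q = sF k (suc q)
    step (suc zero) q = sF k (suc q) + sF k (suc (suc q))
    step (suc (suc j)) q = step j (suc q)

s : ℕ → ℕ
s n = sF (suc n) n

-- t(n) = s(n)/s(n+1)  (s(n+1) ≥ 1 always, so the zero branch never occurs)
t : ℕ → ℚ
t n with s (suc n)
... | zero  = 0ℚ
... | suc d = (+ s n) / suc d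

sumFrom : ℕ → ℕ → (ℕ → ℚ) → ℚ
sumFrom a zero f = 0ℚ
sumFrom a (suc k) f = f a +ℚ sumFrom (suc a) k f

A : ℕ → ℚ
A r = sumFrom (2 ^ r) (2 ^ r) t

Ã : ℕ → ℚ
Ã r = sumFrom 0 (2 ^ r) t

{-# OPTIONS --safe #-}
module Submission where

-- Write N = 2^r.  Row r + 1 of t splits into the pairs t(2n), t(2n+1) with
-- N ≤ n < 2N, and the Stern recurrences give t(2n+1) = t(n) + 1 and
-- t(2n) = s(n) / (s(n) + s(n+1)).  Row r of s is a palindrome,
-- s(N + i) = s(2N − i), so t(2(N+i)) + t(2(N+j)) = 1 whenever i + j + 1 = N and
-- the even-indexed half of row r + 1 sums to N/2.  Hence
-- A(r+1) = A(r) + N + N/2 and Ã(r+1) = Ã(r) + A(r), and induction on r gives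
-- both closed forms.

module SternSequence where
  open import Defs
  open import Data.Nat using (ℕ; zero; suc; 2+; _+_; _*_; _^_; _<_; _≤_; s≤s; z≤n)
  import Data.Nat.Properties as ℕ
  open import Data.Empty using (⊥-elim)
  open import Function using (_∘_)
  open import Relation.Binary.PropositionalEquality
  open ≡-Reasoning

  data EvenOrOdd : ℕ → Set where
    even : ∀ i → EvenOrOdd (2 * i)
    odd  : ∀ i → EvenOrOdd (suc (2 * i))

  evenOrOdd : ∀ n → EvenOrOdd n
  evenOrOdd zero = even 0
  evenOrOdd (suc n) with evenOrOdd n
  ... | even i = odd i
  ... | odd i  = subst EvenOrOdd (ℕ.*-suc 2 i) (even (suc i))

  -- `sF (suc k) (2+ m)` reduces to a local function of Defs, `step`, applied to
  -- `k m m m 0`; it cannot be named, so `sternStep` is a metavariable that the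
  -- `refl` below solves to it (abstracting `2+ j` and `1` makes that a pattern).
  -- Afterwards `sF (suc k) (2+ m)` and `sternStep k m m 0` are definitionally equal.
  mutual
    sternStep : ℕ → ℕ → ℕ → ℕ → ℕ
    sternStep = _

    sF-unfolds-to-sternStep : ∀ k j → sF (suc k) (2+ (2+ j)) ≡ sternStep k (2+ j) j 1
    sF-unfolds-to-sternStep k j with 2+ j | 1
    ... | m | q = refl

  sternStep-even : ∀ k m i q → sternStep k m (2 * i) q ≡ sF k (suc (q + i))
  sternStep-even k m zero    q = cong (sF k ∘ suc) (sym (ℕ.+-identityʳ q))
  sternStep-even k m (suc i) q = begin
    sternStep k m (2 * suc i) q    ≡⟨ cong (λ j → sternStep k m j q) (ℕ.*-suc 2 i) ⟩
    sternStep k m (2 * i) (suc q)  ≡⟨ sternStep-even k m i (suc q) ⟩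
    sF k (2+ (q + i))              ≡⟨ cong (sF k ∘ suc) (ℕ.+-suc q i) ⟨
    sF k (suc (q + suc i))         ∎

  sternStep-odd : ∀ k m i q →
    sternStep k m (suc (2 * i)) q ≡ sF k (suc (q + i)) + sF k (2+ (q + i))
  sternStep-odd k m zero    q = cong (λ p → sF k (suc p) + sF k (2+ p)) (sym (ℕ.+-identityʳ q))
  sternStep-odd k m (suc i) q = begin
    sternStep k m (suc (2 * suc i)) q               ≡⟨ cong (λ j → sternStep k m (suc j) q) (ℕ.*-suc 2 i) ⟩
    sternStep k m (suc (2 * i)) (suc q)             ≡⟨ sternStep-odd k m i (suc q) ⟩
    sF k (2+ (q + i)) + sF k (suc (2+ (q + i)))     ≡⟨ cong (λ p → sF k (suc p) + sF k (2+ p)) (ℕ.+-suc q i) ⟨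
    sF k (suc (q + suc i)) + sF k (2+ (q + suc i))  ∎

  sF[2+2i]≡sF[1+i] : ∀ k i → sF (suc k) (2+ (2 * i)) ≡ sF k (suc i)
  sF[2+2i]≡sF[1+i] k i = sternStep-even k (2 * i) i 0

  sF[3+2i]≡sF[1+i]+sF[2+i] : ∀ k i → sF (suc k) (2+ (suc (2 * i))) ≡ sF k (suc i) + sF k (2+ i)
  sF[3+2i]≡sF[1+i]+sF[2+i] k i = sternStep-odd k (suc (2 * i)) i 0

  1+i<2+2i : ∀ i → suc i < 2+ (2 * i)
  1+i<2+2i i = s≤s (s≤s (ℕ.m≤m+n i (i + 0)))

  2+i<3+2i : ∀ i → 2+ i < 2+ (suc (2 * i))
  2+i<3+2i i = s≤s (1+i<2+2i i)

  1+i<3+2i : ∀ i → suc i < 2+ (suc (2 * i))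
  1+i<3+2i i = ℕ.<-trans (ℕ.n<1+n _) (2+i<3+2i i)

  sF-fuel-irrelevant : ∀ {k k′} n → n < k → n < k′ → sF k n ≡ sF k′ n
  sF-fuel-irrelevant {suc k} {suc k′} 0 _ _ = refl
  sF-fuel-irrelevant {suc k} {suc k′} 1 _ _ = refl
  sF-fuel-irrelevant {suc k} {suc k′} (2+ m) (s≤s 2+m≤k) (s≤s 2+m≤k′) with evenOrOdd m
  ... | even i = begin
    sF (suc k) (2+ (2 * i))   ≡⟨ sF[2+2i]≡sF[1+i] k i ⟩
    sF k (suc i)              ≡⟨ fuel-irrelevant-below (suc i) (1+i<2+2i i) ⟩
    sF k′ (suc i)             ≡⟨ sF[2+2i]≡sF[1+i] k′ i ⟨
    sF (suc k′) (2+ (2 * i))  ∎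
    where
    fuel-irrelevant-below : ∀ j → j < 2+ (2 * i) → sF k j ≡ sF k′ j
    fuel-irrelevant-below j j<2+m = sF-fuel-irrelevant j (ℕ.<-≤-trans j<2+m 2+m≤k) (ℕ.<-≤-trans j<2+m 2+m≤k′)
  ... | odd i = begin
    sF (suc k) (2+ (suc (2 * i)))   ≡⟨ sF[3+2i]≡sF[1+i]+sF[2+i] k i ⟩
    sF k (suc i) + sF k (2+ i)      ≡⟨ cong₂ _+_ (fuel-irrelevant-below (suc i) (1+i<3+2i i))
                                                 (fuel-irrelevant-below (2+ i) (2+i<3+2i i)) ⟩
    sF k′ (suc i) + sF k′ (2+ i)    ≡⟨ sF[3+2i]≡sF[1+i]+sF[2+i] k′ i ⟨
    sF (suc k′) (2+ (suc (2 * i)))  ∎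
    where
    fuel-irrelevant-below : ∀ j → j < 2+ (suc (2 * i)) → sF k j ≡ sF k′ j
    fuel-irrelevant-below j j<2+m = sF-fuel-irrelevant j (ℕ.<-≤-trans j<2+m 2+m≤k) (ℕ.<-≤-trans j<2+m 2+m≤k′)

  s≡sF : ∀ {k} n → n < k → s n ≡ sF k n
  s≡sF n = sF-fuel-irrelevant n (ℕ.n<1+n n)

  s[2n]≡s[n] : ∀ n → s (2 * n) ≡ s n
  s[2n]≡s[n] zero    = refl
  s[2n]≡s[n] (suc n) = begin
    s (2 * suc n)            ≡⟨ cong s (ℕ.*-suc 2 n) ⟩
    s (2+ (2 * n))           ≡⟨ sF[2+2i]≡sF[1+i] (2+ (2 * n)) n ⟩
    sF (2+ (2 * n)) (suc n)  ≡⟨ s≡sF (suc n) (1+i<2+2i n) ⟨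
    s (suc n)                ∎

  s[1+2n]≡s[n]+s[1+n] : ∀ n → s (suc (2 * n)) ≡ s n + s (suc n)
  s[1+2n]≡s[n]+s[1+n] zero    = refl
  s[1+2n]≡s[n]+s[1+n] (suc n) = begin
    s (suc (2 * suc n))         ≡⟨ cong (s ∘ suc) (ℕ.*-suc 2 n) ⟩
    s (2+ (suc (2 * n)))        ≡⟨ sF[3+2i]≡sF[1+i]+sF[2+i] (2+ (suc (2 * n))) n ⟩
    sF K (suc n) + sF K (2+ n)  ≡⟨ cong₂ _+_ (s≡sF (suc n) (1+i<3+2i n)) (s≡sF (2+ n) (2+i<3+2i n)) ⟨
    s (suc n) + s (2+ n)        ∎
    where K = 2+ (suc (2 * n))

  0<sF : ∀ {k} n → suc n < k → 0 < sF k (suc n)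
  0<sF {suc k} zero    _ = s≤s z≤n
  0<sF {suc k} (suc m) (s≤s 2+m≤k) with evenOrOdd m
  ... | even i = subst (0 <_) (sym (sF[2+2i]≡sF[1+i] k i)) (0<sF i (ℕ.<-≤-trans (1+i<2+2i i) 2+m≤k))
  ... | odd i  = subst (0 <_) (sym (sF[3+2i]≡sF[1+i]+sF[2+i] k i))
                   (ℕ.<-≤-trans (0<sF i (ℕ.<-≤-trans (1+i<3+2i i) 2+m≤k)) (ℕ.m≤m+n _ _))

  0<s[1+n] : ∀ n → 0 < s (suc n)
  0<s[1+n] n = 0<sF n (ℕ.n<1+n (suc n))

  s[2m+2n]≡s[m+n] : ∀ m n → s (2 * m + 2 * n) ≡ s (m + n)
  s[2m+2n]≡s[m+n] m n = trans (cong s (sym (ℕ.*-distribˡ-+ 2 m n))) (s[2n]≡s[n] (m + n))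

  s[2m+1+2n]≡s[m+n]+s[m+1+n] : ∀ m n → s (2 * m + suc (2 * n)) ≡ s (m + n) + s (m + suc n)
  s[2m+1+2n]≡s[m+n]+s[m+1+n] m n = begin
    s (2 * m + suc (2 * n))      ≡⟨ cong s (ℕ.+-suc (2 * m) (2 * n)) ⟩
    s (suc (2 * m + 2 * n))      ≡⟨ cong (s ∘ suc) (ℕ.*-distribˡ-+ 2 m n) ⟨
    s (suc (2 * (m + n)))        ≡⟨ s[1+2n]≡s[n]+s[1+n] (m + n) ⟩
    s (m + n) + s (suc (m + n))  ≡⟨ cong (λ p → s (m + n) + s p) (ℕ.+-suc m n) ⟨
    s (m + n) + s (m + suc n)    ∎

  2i+2j≡2n⇒i+j≡n : ∀ {i j n} → 2 * i + 2 * j ≡ 2 * n → i + j ≡ n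
  2i+2j≡2n⇒i+j≡n {i} {j} e = ℕ.*-cancelˡ-≡ _ _ 2 (trans (ℕ.*-distribˡ-+ 2 i j) e)

  [1+2i]+[1+2j]≡2n⇒1+i+j≡n : ∀ {i j n} → suc (2 * i) + suc (2 * j) ≡ 2 * n → suc (i + j) ≡ n
  [1+2i]+[1+2j]≡2n⇒1+i+j≡n {i} {j} {n} e = ℕ.*-cancelˡ-≡ _ _ 2 (begin
    2 * suc (i + j)             ≡⟨ ℕ.*-suc 2 (i + j) ⟩
    2+ (2 * (i + j))            ≡⟨ cong 2+ (ℕ.*-distribˡ-+ 2 i j) ⟩
    2+ (2 * i + 2 * j)          ≡⟨ cong suc (ℕ.+-suc (2 * i) (2 * j)) ⟨
    suc (2 * i) + suc (2 * j)   ≡⟨ e ⟩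
    2 * n                       ∎)

  s-row-palindrome : ∀ r k k′ → k + k′ ≡ 2 ^ r → s (2 ^ r + k) ≡ s (2 ^ r + k′)
  s-row-palindrome zero 0 1 _ = refl
  s-row-palindrome zero 1 0 _ = refl
  s-row-palindrome (suc r) k k′ k+k′≡2N with evenOrOdd k | evenOrOdd k′
  ... | even i | even i′ = begin
    s (2 * N + 2 * i)   ≡⟨ s[2m+2n]≡s[m+n] N i ⟩
    s (N + i)           ≡⟨ s-row-palindrome r i i′ (2i+2j≡2n⇒i+j≡n {i} {i′} {N} k+k′≡2N) ⟩
    s (N + i′)          ≡⟨ s[2m+2n]≡s[m+n] N i′ ⟨
    s (2 * N + 2 * i′)  ∎
    where N = 2 ^ r
  ... | odd i | odd i′ = begin
    s (2 * N + suc (2 * i))      ≡⟨ s[2m+1+2n]≡s[m+n]+s[m+1+n] N i ⟩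
    s (N + i) + s (N + suc i)    ≡⟨ cong₂ _+_ (s-row-palindrome r i (suc i′) (trans (ℕ.+-suc i i′) i+i′+1≡N))
                                              (s-row-palindrome r (suc i) i′ i+i′+1≡N) ⟩
    s (N + suc i′) + s (N + i′)  ≡⟨ ℕ.+-comm (s (N + suc i′)) (s (N + i′)) ⟩
    s (N + i′) + s (N + suc i′)  ≡⟨ s[2m+1+2n]≡s[m+n]+s[m+1+n] N i′ ⟨
    s (2 * N + suc (2 * i′))     ∎
    where
    N = 2 ^ r
    i+i′+1≡N : suc (i + i′) ≡ N
    i+i′+1≡N = [1+2i]+[1+2j]≡2n⇒1+i+j≡n {i} {i′} {N} k+k′≡2N
  ... | even i | odd i′ = ⊥-elim (ℕ.even≢odd (2 ^ r) (i + i′) (sym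
    (trans (cong suc (ℕ.*-distribˡ-+ 2 i i′)) (trans (sym (ℕ.+-suc (2 * i) (2 * i′))) k+k′≡2N))))
  ... | odd i | even i′ = ⊥-elim (ℕ.even≢odd (2 ^ r) (i + i′) (sym
    (trans (cong suc (ℕ.*-distribˡ-+ 2 i i′)) k+k′≡2N)))

module RowSums where
  open import Defs
  open SternSequence
  open import Data.Nat as ℕ using (ℕ; zero; suc; 2+; _^_; _<_)
  import Data.Nat.Properties as ℕ
  import Data.Integer as ℤ
  import Data.Integer.Properties as ℤ
  import Data.Integer.Solver as ℤ-Solver
  open import Data.Rational using (ℚ; _/_; 0ℚ; 1ℚ; _+_; _-_; _*_; fromℚᵘ)
  import Data.Rational.Properties as ℚ
  import Data.Rational.Solver as ℚ-Solver
  open import Data.Rational.Unnormalised as ℚᵘ using (ℚᵘ; mkℚᵘ; *≡*)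
  import Data.Rational.Unnormalised.Properties as ℚᵘ
  open import Algebra.Bundles using (CommutativeMonoid)
  open import Algebra.Properties.CommutativeSemigroup (CommutativeMonoid.commutativeSemigroup ℚ.+-0-commutativeMonoid) using (interchange)
  open import Relation.Binary.PropositionalEquality
  open ≡-Reasoning

  fromℚᵘ-homo-+ : ∀ (p q : ℚᵘ) → fromℚᵘ (p ℚᵘ.+ q) ≡ fromℚᵘ p + fromℚᵘ q
  fromℚᵘ-homo-+ p q = ℚ.toℚᵘ-injective (ℚᵘ.≃-trans (ℚ.toℚᵘ-fromℚᵘ (p ℚᵘ.+ q)) (ℚᵘ.≃-sym
    (ℚᵘ.≃-trans (ℚ.toℚᵘ-homo-+ (fromℚᵘ p) (fromℚᵘ q)) (ℚᵘ.+-cong (ℚ.toℚᵘ-fromℚᵘ p) (ℚ.toℚᵘ-fromℚᵘ q)))))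

  mkℚᵘ-+ : ∀ a b d → mkℚᵘ a d ℚᵘ.+ mkℚᵘ b d ℚᵘ.≃ mkℚᵘ (a ℤ.+ b) d
  mkℚᵘ-+ a b d = *≡* (solve 3 (λ a b D → (a :* D :+ b :* D) :* D := (a :+ b) :* (D :* D)) refl a b (ℤ.+ suc d))
    where open ℤ-Solver.+-*-Solver

  -- `a /ℕ 0 = 0ℚ`, the same junk value `t` takes, so `t≡s/ℕs` needs no positivity.
  infixl 7 _/ℕ_

  _/ℕ_ : ℕ → ℕ → ℚ
  a /ℕ zero  = 0ℚ
  a /ℕ suc d = ℤ.+ a / suc d

  /ℕ-+ : ∀ a b d → a /ℕ d + b /ℕ d ≡ (a ℕ.+ b) /ℕ d
  /ℕ-+ a b zero    = refl
  /ℕ-+ a b (suc d) = trans (sym (fromℚᵘ-homo-+ (mkℚᵘ (ℤ.+ a) d) (mkℚᵘ (ℤ.+ b) d)))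
                           (ℚ.fromℚᵘ-cong (mkℚᵘ-+ (ℤ.+ a) (ℤ.+ b) d))

  n/ℕn≡1 : ∀ n → 0 < n → n /ℕ n ≡ 1ℚ
  n/ℕn≡1 (suc d) _ = ℚ.fromℚᵘ-cong {mkℚᵘ (ℤ.+ suc d) d} {ℚᵘ.1ℚᵘ} (*≡* (ℤ.*-comm (ℤ.+ suc d) (ℤ.+ 1)))

  sumFrom-cong : ∀ a n {f g : ℕ → ℚ} → (∀ x → f x ≡ g x) → sumFrom a n f ≡ sumFrom a n g
  sumFrom-cong a zero    f≗g = refl
  sumFrom-cong a (suc n) f≗g = cong₂ _+_ (f≗g a) (sumFrom-cong (suc a) n f≗g)

  sumFrom-+ : ∀ a m n f → sumFrom a (m ℕ.+ n) f ≡ sumFrom a m f + sumFrom (a ℕ.+ m) n f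
  sumFrom-+ a zero    n f = begin
    sumFrom a n f               ≡⟨ cong (λ b → sumFrom b n f) (ℕ.+-identityʳ a) ⟨
    sumFrom (a ℕ.+ 0) n f       ≡⟨ ℚ.+-identityˡ _ ⟨
    0ℚ + sumFrom (a ℕ.+ 0) n f  ∎
  sumFrom-+ a (suc m) n f = begin
    f a + sumFrom (suc a) (m ℕ.+ n) f                        ≡⟨ cong (f a +_) (sumFrom-+ (suc a) m n f) ⟩
    f a + (sumFrom (suc a) m f + sumFrom (suc a ℕ.+ m) n f)  ≡⟨ ℚ.+-assoc (f a) _ _ ⟨
    f a + sumFrom (suc a) m f + sumFrom (suc a ℕ.+ m) n f    ≡⟨ cong (λ b → f a + sumFrom (suc a) m f + sumFrom b n f) (ℕ.+-suc a m) ⟨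
    f a + sumFrom (suc a) m f + sumFrom (a ℕ.+ suc m) n f    ∎

  sumFrom-suc : ∀ a n f → sumFrom a (suc n) f ≡ sumFrom a n f + f (a ℕ.+ n)
  sumFrom-suc a n f = begin
    sumFrom a (suc n) f                 ≡⟨ cong (λ k → sumFrom a k f) (ℕ.+-comm 1 n) ⟩
    sumFrom a (n ℕ.+ 1) f               ≡⟨ sumFrom-+ a n 1 f ⟩
    sumFrom a n f + (f (a ℕ.+ n) + 0ℚ)  ≡⟨ cong (sumFrom a n f +_) (ℚ.+-identityʳ _) ⟩
    sumFrom a n f + f (a ℕ.+ n)         ∎

  sumFrom-merge : ∀ a n f g → sumFrom a n (λ x → f x + g x) ≡ sumFrom a n f + sumFrom a n g
  sumFrom-merge a zero    f g = refl
  sumFrom-merge a (suc n) f g = trans (cong (f a + g a +_) (sumFrom-merge (suc a) n f g))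
    (interchange (f a) (g a) (sumFrom (suc a) n f) (sumFrom (suc a) n g))

  sumFrom-pairs : ∀ a n f →
    sumFrom (2 ℕ.* a) (2 ℕ.* n) f ≡ sumFrom a n (λ x → f (2 ℕ.* x) + f (suc (2 ℕ.* x)))
  sumFrom-pairs a zero    f = refl
  sumFrom-pairs a (suc n) f = begin
    sumFrom (2 ℕ.* a) (2 ℕ.* suc n) f
      ≡⟨ cong (λ k → sumFrom (2 ℕ.* a) k f) (ℕ.*-suc 2 n) ⟩
    f (2 ℕ.* a) + (f (suc (2 ℕ.* a)) + sumFrom (2+ (2 ℕ.* a)) (2 ℕ.* n) f)
      ≡⟨ ℚ.+-assoc (f (2 ℕ.* a)) _ _ ⟨
    f (2 ℕ.* a) + f (suc (2 ℕ.* a)) + sumFrom (2+ (2 ℕ.* a)) (2 ℕ.* n) f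
      ≡⟨ cong (λ b → f (2 ℕ.* a) + f (suc (2 ℕ.* a)) + sumFrom b (2 ℕ.* n) f) (ℕ.*-suc 2 a) ⟨
    f (2 ℕ.* a) + f (suc (2 ℕ.* a)) + sumFrom (2 ℕ.* suc a) (2 ℕ.* n) f
      ≡⟨ cong (f (2 ℕ.* a) + f (suc (2 ℕ.* a)) +_) (sumFrom-pairs (suc a) n f) ⟩
    sumFrom a (suc n) (λ x → f (2 ℕ.* x) + f (suc (2 ℕ.* x)))
      ∎

  sumFrom-reverse : ∀ a b n {f g : ℕ → ℚ} →
    (∀ i j → suc (i ℕ.+ j) ≡ n → f (a ℕ.+ i) ≡ g (b ℕ.+ j)) → sumFrom a n f ≡ sumFrom b n g
  sumFrom-reverse a b zero    _ = refl
  sumFrom-reverse a b (suc n) {f} {g} f≡g-reversed = begin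
    f a + sumFrom (suc a) n f    ≡⟨ cong₂ _+_ first rest ⟩
    g (b ℕ.+ n) + sumFrom b n g  ≡⟨ ℚ.+-comm (g (b ℕ.+ n)) _ ⟩
    sumFrom b n g + g (b ℕ.+ n)  ≡⟨ sumFrom-suc b n g ⟨
    sumFrom b (suc n) g          ∎
    where
    first : f a ≡ g (b ℕ.+ n)
    first = trans (cong f (sym (ℕ.+-identityʳ a))) (f≡g-reversed 0 n refl)
    rest : sumFrom (suc a) n f ≡ sumFrom b n g
    rest = sumFrom-reverse (suc a) b n λ i j i+j+1≡n →
      trans (cong f (sym (ℕ.+-suc a i))) (f≡g-reversed (suc i) j (cong suc i+j+1≡n))

  sumFrom-ones : ∀ a n → sumFrom a n (λ _ → 1ℚ) ≡ n /ℕ 1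
  sumFrom-ones a zero    = refl
  sumFrom-ones a (suc n) = trans (cong (1ℚ +_) (sumFrom-ones (suc a) n)) (/ℕ-+ 1 n 1)

  t≡s/ℕs : ∀ n → t n ≡ s n /ℕ s (suc n)
  t≡s/ℕs n with s (suc n)
  ... | zero  = refl
  ... | suc d = refl

  t[1+2n]≡t[n]+1 : ∀ n → t (suc (2 ℕ.* n)) ≡ t n + 1ℚ
  t[1+2n]≡t[n]+1 n = begin
    t (suc (2 ℕ.* n))                          ≡⟨ t≡s/ℕs (suc (2 ℕ.* n)) ⟩
    s (suc (2 ℕ.* n)) /ℕ s (2+ (2 ℕ.* n))      ≡⟨ cong₂ _/ℕ_ (s[1+2n]≡s[n]+s[1+n] n) s[2+2n]≡s[1+n] ⟩
    (s n ℕ.+ s (suc n)) /ℕ s (suc n)           ≡⟨ /ℕ-+ (s n) (s (suc n)) (s (suc n)) ⟨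
    s n /ℕ s (suc n) + s (suc n) /ℕ s (suc n)  ≡⟨ cong₂ _+_ (sym (t≡s/ℕs n)) (n/ℕn≡1 (s (suc n)) (0<s[1+n] n)) ⟩
    t n + 1ℚ                                   ∎
    where
    s[2+2n]≡s[1+n] : s (2+ (2 ℕ.* n)) ≡ s (suc n)
    s[2+2n]≡s[1+n] = trans (cong s (sym (ℕ.*-suc 2 n))) (s[2n]≡s[n] (suc n))

  t[2m]+t[2n]≡1 : ∀ {m n} → s m ≡ s (suc n) → s (suc m) ≡ s n → t (2 ℕ.* m) + t (2 ℕ.* n) ≡ 1ℚ
  t[2m]+t[2n]≡1 {m} {n} sm≡s[1+n] s[1+m]≡sn = begin
    t (2 ℕ.* m) + t (2 ℕ.* n)
      ≡⟨ cong₂ _+_ (t≡s/ℕs (2 ℕ.* m)) (t≡s/ℕs (2 ℕ.* n)) ⟩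
    s (2 ℕ.* m) /ℕ s (suc (2 ℕ.* m)) + s (2 ℕ.* n) /ℕ s (suc (2 ℕ.* n))
      ≡⟨ cong₂ _+_ (cong₂ _/ℕ_ (s[2n]≡s[n] m) (s[1+2n]≡s[n]+s[1+n] m))
                   (cong₂ _/ℕ_ (s[2n]≡s[n] n) (s[1+2n]≡s[n]+s[1+n] n)) ⟩
    s m /ℕ D + s n /ℕ (s n ℕ.+ s (suc n))
      ≡⟨ cong (s m /ℕ D +_) (cong₂ _/ℕ_ (sym s[1+m]≡sn) D′≡D) ⟩
    s m /ℕ D + s (suc m) /ℕ D
      ≡⟨ /ℕ-+ (s m) (s (suc m)) D ⟩
    D /ℕ D
      ≡⟨ n/ℕn≡1 D (ℕ.<-≤-trans (0<s[1+n] m) (ℕ.m≤n+m _ (s m))) ⟩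
    1ℚ ∎
    where
    D = s m ℕ.+ s (suc m)
    D′≡D : s n ℕ.+ s (suc n) ≡ D
    D′≡D = trans (cong₂ ℕ._+_ (sym s[1+m]≡sn) (sym sm≡s[1+n])) (ℕ.+-comm (s (suc m)) (s m))

  A-evens : ℕ → ℚ
  A-evens r = sumFrom (2 ^ r) (2 ^ r) (λ n → t (2 ℕ.* n))

  A-evens-doubled : ∀ r → A-evens r + A-evens r ≡ 2 ^ r /ℕ 1
  A-evens-doubled r = begin
    A-evens r + A-evens r                                 ≡⟨ cong (A-evens r +_) (sumFrom-reverse N N N reflected) ⟩
    A-evens r + sumFrom N N (λ n → 1ℚ - t (2 ℕ.* n))      ≡⟨ sumFrom-merge N N _ _ ⟨
    sumFrom N N (λ n → t (2 ℕ.* n) + (1ℚ - t (2 ℕ.* n)))  ≡⟨ sumFrom-cong N N (λ n → p+[1-p]≡1 (t (2 ℕ.* n))) ⟩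
    sumFrom N N (λ _ → 1ℚ)                                ≡⟨ sumFrom-ones N N ⟩
    N /ℕ 1                                                ∎
    where
    open ℚ-Solver.+-*-Solver
    N = 2 ^ r
    p+[1-p]≡1 : ∀ p → p + (1ℚ - p) ≡ 1ℚ
    p+[1-p]≡1 = solve 1 (λ p → p :+ (con 1ℚ :- p) := con 1ℚ) refl
    p≡[p+q]-q : ∀ p q → p ≡ (p + q) - q
    p≡[p+q]-q = solve 2 (λ p q → p := (p :+ q) :- q) refl
    reflected : ∀ i j → suc (i ℕ.+ j) ≡ N → t (2 ℕ.* (N ℕ.+ i)) ≡ 1ℚ - t (2 ℕ.* (N ℕ.+ j))
    reflected i j i+j+1≡N = trans (p≡[p+q]-q _ _) (cong (_- t (2 ℕ.* (N ℕ.+ j))) (t[2m]+t[2n]≡1 {N ℕ.+ i} {N ℕ.+ j}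
      (trans (s-row-palindrome r i (suc j) (trans (ℕ.+-suc i j) i+j+1≡N)) (cong s (ℕ.+-suc N j)))
      (trans (cong s (sym (ℕ.+-suc N i))) (s-row-palindrome r (suc i) j i+j+1≡N))))

  A-suc : ∀ r → A (suc r) ≡ A-evens r + (A r + 2 ^ r /ℕ 1)
  A-suc r = begin
    A (suc r)                                            ≡⟨ sumFrom-pairs N N t ⟩
    sumFrom N N (λ n → t (2 ℕ.* n) + t (suc (2 ℕ.* n)))  ≡⟨ sumFrom-cong N N (λ n → cong (t (2 ℕ.* n) +_) (t[1+2n]≡t[n]+1 n)) ⟩
    sumFrom N N (λ n → t (2 ℕ.* n) + (t n + 1ℚ))         ≡⟨ sumFrom-merge N N _ _ ⟩
    A-evens r + sumFrom N N (λ n → t n + 1ℚ)             ≡⟨ cong (A-evens r +_) (sumFrom-merge N N t _) ⟩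
    A-evens r + (A r + sumFrom N N (λ _ → 1ℚ))           ≡⟨ cong (λ x → A-evens r + (A r + x)) (sumFrom-ones N N) ⟩
    A-evens r + (A r + N /ℕ 1)                           ∎
    where N = 2 ^ r

  2^r+2^r≡2^[1+r] : ∀ r → 2 ^ r ℕ.+ 2 ^ r ≡ 2 ^ suc r
  2^r+2^r≡2^[1+r] r = cong (2 ^ r ℕ.+_) (sym (ℕ.+-identityʳ (2 ^ r)))

  Ã-suc : ∀ r → Ã (suc r) ≡ Ã r + A r
  Ã-suc r = trans (cong (λ k → sumFrom 0 k t) (sym (2^r+2^r≡2^[1+r] r))) (sumFrom-+ 0 (2 ^ r) (2 ^ r) t)

  2^[1+r]/ℕ1 : ∀ r → 2 ^ suc r /ℕ 1 ≡ 2 ^ r /ℕ 1 + 2 ^ r /ℕ 1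
  2^[1+r]/ℕ1 r = trans (cong (_/ℕ 1) (sym (2^r+2^r≡2^[1+r] r))) (sym (/ℕ-+ (2 ^ r) (2 ^ r) 1))

  ½ ³⁄₂ : ℚ
  ½ = ℤ.+ 1 / 2
  ³⁄₂ = ℤ.+ 3 / 2

  A-closed : ∀ r → A r ≡ ³⁄₂ * (2 ^ r /ℕ 1) - ½
  A-closed zero    = refl
  A-closed (suc r) = begin
    A (suc r)                    ≡⟨ A-suc r ⟩
    A-evens r + (A r + N)        ≡⟨ cong₂ (λ e a → e + (a + N)) A-evens≡½N (A-closed r) ⟩
    ½ * N + ((³⁄₂ * N - ½) + N)
      ≡⟨ solve 1 (λ x → con ½ :* x :+ ((con ³⁄₂ :* x :- con ½) :+ x) := con ³⁄₂ :* (x :+ x) :- con ½) refl N ⟩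
    ³⁄₂ * (N + N) - ½            ≡⟨ cong (λ x → ³⁄₂ * x - ½) (2^[1+r]/ℕ1 r) ⟨
    ³⁄₂ * (2 ^ suc r /ℕ 1) - ½   ∎
    where
    open ℚ-Solver.+-*-Solver
    N = 2 ^ r /ℕ 1
    A-evens≡½N : A-evens r ≡ ½ * N
    A-evens≡½N = trans (solve 1 (λ x → x := con ½ :* (x :+ x)) refl (A-evens r)) (cong (½ *_) (A-evens-doubled r))

  Ã-closed : ∀ r → Ã r ≡ ³⁄₂ * (2 ^ r /ℕ 1) - (r ℕ.+ 3) /ℕ 2
  Ã-closed zero    = refl
  Ã-closed (suc r) = begin
    Ã (suc r)                      ≡⟨ Ã-suc r ⟩
    Ã r + A r                      ≡⟨ cong₂ _+_ (Ã-closed r) (A-closed r) ⟩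
    (³⁄₂ * N - R) + (³⁄₂ * N - ½)
      ≡⟨ solve 2 (λ x y → (con ³⁄₂ :* x :- y) :+ (con ³⁄₂ :* x :- con ½) := con ³⁄₂ :* (x :+ x) :- (con ½ :+ y)) refl N R ⟩
    ³⁄₂ * (N + N) - (½ + R)
      ≡⟨ cong₂ (λ x y → ³⁄₂ * x - y) (sym (2^[1+r]/ℕ1 r)) (/ℕ-+ 1 (r ℕ.+ 3) 2) ⟩
    ³⁄₂ * (2 ^ suc r /ℕ 1) - (suc r ℕ.+ 3) /ℕ 2
      ∎
    where
    open ℚ-Solver.+-*-Solver
    N = 2 ^ r /ℕ 1
    R = (r ℕ.+ 3) /ℕ 2

open import Defs
open import Data.Nat using (ℕ; _+_; _^_)
open import Data.Integer using (+_)
open import Data.Rational using (ℚ; _/_; _-_; _*_)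
open import Data.Product using (_×_; _,_)
open import Relation.Binary.PropositionalEquality using (_≡_)
open RowSums using (A-closed; Ã-closed)

lemma3p1 : (r : ℕ) →
    (A r ≡ (+ 3 / 2) * (+ (2 ^ r) / 1) - (+ 1 / 2)) ×
    (Ã r ≡ (+ 3 / 2) * (+ (2 ^ r) / 1) - (+ (r + 3) / 2))
lemma3p1 r = A-closed r , Ã-closed r
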